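{- Let $\delta,\beta>0$, let $T$ be a tournament on $[n]$, and let $\mathcal T$ be any rooted tree produced by the following procedure. Start with the single root node $[n]$. While there is an unprocessed node $V$ with $|V|\ge \sqrt n$, choose a partition $V=L\cup R\cup W$ with $|L|,|R|>\beta|V|$ such that $T\cap(L\times R)$ is $\delta$-regular of density at least $1/2$ ($W$ may be empty), make the nonempty ones among $L,R,W$ the children of $V$, and mark $V$ processed. (Nodes of size less than $\sqrt n$ are never processed and are leaves.) Then the number $m$ of internal nodes of the final tree $\mathcal T$ is less than $n$.
   Context: Nodes of the tree are subsets of $[n]$ and the size of a node is its cardinality. For disjoint $L,R\subseteq[n]$ and $D=T\cap(L\times R)$ (the arcs of $T$ from $L$ to $R$), the density is $d_D(L,R)=|D|/(|L||R|)$, and $D$ is $\delta$-regular if $|d_D(L',R')-d_D(L,R)|<\delta$ for all $L'\subseteq L$, $R'\subseteq R$ with $|L'|>\delta|L|$, $|R'|>\delta|R|$, where $d_D(L',R')=|D\cap(L'\times R')|/(|L'||R'|)$.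
   Formalization: The parameters δ and β range over the positive rationals. -}

module Defs where

open import Data.Bool using (Bool; true; false; not; _∧_; if_then_else_)
open import Data.Nat as ℕ using (ℕ; zero; suc; _+_; _<_; _≤_)
open import Data.Fin using (Fin)
open import Data.Fin.Subset using (Subset; _⊆_; ∣_∣; _∪_; _∩_; ⊤; ⊥; Nonempty)
open import Data.Vec using (lookup)
open import Data.List using (map; allFin)
open import Data.Nat.ListAction using (sum)
open import Data.Integer using (+_)
open import Data.Rational using (ℚ; _/_; 0ℚ; ½; _*_; _-_) renaming (∣_∣ to absℚ; _<_ to _<ℚ_; _≤_ to _≤ℚ_)
open import Data.Product using (_×_; _,_)
open import Data.Sum using (_⊎_; inj₁; inj₂)
open import Relation.Binary.PropositionalEquality using (_≡_; _≢_)

ℕ→ℚ : ℕ → ℚ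
ℕ→ℚ k = + k / 1

-- A tournament on [n] = Fin n: T i j = true iff the arc i → j is present.
IsTournament : (n : ℕ) → (Fin n → Fin n → Bool) → Set
IsTournament n T =
  (∀ i → T i i ≡ false) × (∀ i j → i ≢ j → T i j ≡ not (T j i))

ΣFin : (n : ℕ) → (Fin n → ℕ) → ℕ
ΣFin n f = sum (map f (allFin n))

bool→ℕ : Bool → ℕ
bool→ℕ true = 1
bool→ℕ false = 0

arcs : {n : ℕ} → (Fin n → Fin n → Bool) → Subset n → Subset n → ℕ
arcs {n} T L R =
  ΣFin n (λ i → ΣFin n (λ j → bool→ℕ (lookup L i ∧ (lookup R j ∧ T i j))))

-- a / b as a rational (only ever used with b ≠ 0; set to 0 when b = 0)
ratio : ℕ → ℕ → ℚ
ratio a zero = 0ℚ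
ratio a (suc b) = + a / suc b

-- density d_D(L', R') = |D ∩ (L' × R')| / (|L'| |R'|) with D = T ∩ (L × R)
-- (for L' ⊆ L, R' ⊆ R this is arcs T L' R' / (|L'| |R'|))
density : {n : ℕ} → (Fin n → Fin n → Bool) → Subset n → Subset n → ℚ
density T L R = ratio (arcs T L R) (∣ L ∣ ℕ.* ∣ R ∣)

Regular : {n : ℕ} → ℚ → (Fin n → Fin n → Bool) → Subset n → Subset n → Set
Regular {n} δ T L R =
  (L' R' : Subset n) → L' ⊆ L → R' ⊆ R →
  δ * ℕ→ℚ ∣ L ∣ <ℚ ℕ→ℚ ∣ L' ∣ → δ * ℕ→ℚ ∣ R ∣ <ℚ ℕ→ℚ ∣ R' ∣ →
  absℚ (density T L' R' - density T L R) <ℚ δ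

IsPartition3 : {n : ℕ} → Subset n → Subset n → Subset n → Subset n → Set
IsPartition3 V L R W =
  (L ∪ (R ∪ W) ≡ V) × (L ∩ R ≡ ⊥) × (L ∩ W ≡ ⊥) × (R ∩ W ≡ ⊥)

-- Completed trees produced by the procedure, rooted at node V.
-- |V| ≥ √n is expressed as n ≤ |V|², |V| < √n as |V|² < n.
data ProcTree (n : ℕ) (T : Fin n → Fin n → Bool) (δ β : ℚ) : Subset n → Set where
  leaf : {V : Subset n} → ∣ V ∣ ℕ.* ∣ V ∣ < n → ProcTree n T δ β V
  node : {V : Subset n} (L R W : Subset n) →
         n ≤ ∣ V ∣ ℕ.* ∣ V ∣ →
         IsPartition3 V L R W →
         β * ℕ→ℚ ∣ V ∣ <ℚ ℕ→ℚ ∣ L ∣ →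
         β * ℕ→ℚ ∣ V ∣ <ℚ ℕ→ℚ ∣ R ∣ →
         Regular δ T L R →
         ½ ≤ℚ density T L R →
         ProcTree n T δ β L →
         ProcTree n T δ β R →
         (W ≡ ⊥) ⊎ (Nonempty W × ProcTree n T δ β W) →
         ProcTree n T δ β V

internalNodes : {n : ℕ} {T : Fin n → Fin n → Bool} {δ β : ℚ} {V : Subset n} →
                ProcTree n T δ β V → ℕ
internalNodes (leaf _) = 0
internalNodes (node L R W _ _ _ _ _ _ tL tR (inj₁ _)) =
  suc (internalNodes tL + internalNodes tR)
internalNodes (node L R W _ _ _ _ _ _ tL tR (inj₂ (_ , tW))) =
  suc (internalNodes tL + internalNodes tR + internalNodes tW)

module Submission where

-- In a tree produced by the procedure every node is split into
-- at least two nonempty, pairwise disjoint children whose sizes add up to the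
-- size of the node.  Such a tree over a nonempty node V has fewer internal
-- nodes than V has elements: by induction, a node with children C₁,…,C_k
-- (k ≥ 2) has at most 1 + Σ (|Cᵢ| - 1) ≤ |V| - 1 internal nodes.  Neither
-- regularity nor the tournament property nor the size thresholds matter.

open import Defs
open import Data.Nat using (ℕ; zero; suc; _+_; _*_; _≤_; _<_; z≤n; s≤s)
open import Data.Nat.Base using (>-nonZero; >-nonZero⁻¹)
open import Data.Nat.Properties
  using (+-suc; +-assoc; +-identityʳ; +-mono-≤; ≤-trans; ≤-<-trans; <-≤-trans;
         n≤1+n; m*n≢0⇒m≢0; m*n≢0⇒n≢0; module ≤-Reasoning)
open import Data.Fin using (Fin)
open import Data.Bool using (Bool; true; false)
open import Data.Vec using ([]; _∷_; tail)
open import Data.Fin.Subset using (Subset; ∣_∣; _∪_; _∩_; ⊤; ⊥; Nonempty)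
open import Data.Fin.Subset.Properties
  using (∣⊥∣≡0; ∣⊤∣≡n; ∣p∣≤n; x∈p⇒∣p-x∣<∣p∣; ∩-distribˡ-∪; ∪-identityˡ)
open import Data.Product using (_×_; _,_; proj₁; proj₂)
open import Data.Sum using (inj₁; inj₂)
open import Data.Integer using (+≤+)
open import Data.Rational using (ℚ; 0ℚ; ½; *≤*)
  renaming (_<_ to _<ℚ_; _≤_ to _≤ℚ_)
open import Relation.Binary.PropositionalEquality
  using (_≡_; refl; sym; trans; cong; cong₂; subst; module ≡-Reasoning)

∣p∪q∣≡∣p∣+∣q∣ : ∀ {n} (p q : Subset n) → p ∩ q ≡ ⊥ → ∣ p ∪ q ∣ ≡ ∣ p ∣ + ∣ q ∣
∣p∪q∣≡∣p∣+∣q∣ []          []          _  = refl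
∣p∪q∣≡∣p∣+∣q∣ (true  ∷ p) (true  ∷ q) ()
∣p∪q∣≡∣p∣+∣q∣ (true  ∷ p) (false ∷ q) eq =
  cong suc (∣p∪q∣≡∣p∣+∣q∣ p q (cong tail eq))
∣p∪q∣≡∣p∣+∣q∣ (false ∷ p) (true  ∷ q) eq =
  trans (cong suc (∣p∪q∣≡∣p∣+∣q∣ p q (cong tail eq))) (sym (+-suc ∣ p ∣ ∣ q ∣))
∣p∪q∣≡∣p∣+∣q∣ (false ∷ p) (false ∷ q) eq = ∣p∪q∣≡∣p∣+∣q∣ p q (cong tail eq)

partition-size : ∀ {n} {V L R W : Subset n} → IsPartition3 V L R W →
                 ∣ V ∣ ≡ ∣ L ∣ + (∣ R ∣ + ∣ W ∣)
partition-size {n} {V} {L} {R} {W} (L∪R∪W≡V , L∩R≡⊥ , L∩W≡⊥ , R∩W≡⊥) = begin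
  ∣ V ∣                    ≡⟨ cong ∣_∣ (sym L∪R∪W≡V) ⟩
  ∣ L ∪ (R ∪ W) ∣          ≡⟨ ∣p∪q∣≡∣p∣+∣q∣ L (R ∪ W) L∩[R∪W]≡⊥ ⟩
  ∣ L ∣ + ∣ R ∪ W ∣        ≡⟨ cong (∣ L ∣ +_) (∣p∪q∣≡∣p∣+∣q∣ R W R∩W≡⊥) ⟩
  ∣ L ∣ + (∣ R ∣ + ∣ W ∣)  ∎
  where
  open ≡-Reasoning
  L∩[R∪W]≡⊥ : L ∩ (R ∪ W) ≡ ⊥
  L∩[R∪W]≡⊥ = begin
    L ∩ (R ∪ W)        ≡⟨ ∩-distribˡ-∪ L R W ⟩
    (L ∩ R) ∪ (L ∩ W)  ≡⟨ cong₂ _∪_ L∩R≡⊥ L∩W≡⊥ ⟩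
    ⊥ ∪ ⊥              ≡⟨ ∪-identityˡ ⊥ ⟩
    ⊥                  ∎

nonempty⇒size>0 : ∀ {n} {S : Subset n} → Nonempty S → 0 < ∣ S ∣
nonempty⇒size>0 (x , x∈S) = ≤-<-trans z≤n (x∈p⇒∣p-x∣<∣p∣ x∈S)

-- A ratio with zero denominator is 0, so a ratio of at least ½ has a
-- positive denominator.
½≤ratio⇒denominator>0 : ∀ a b → ½ ≤ℚ ratio a b → 0 < b
½≤ratio⇒denominator>0 a zero    (*≤* (+≤+ ()))
½≤ratio⇒denominator>0 a (suc b) _ = s≤s z≤n

product>0⇒factors>0 : ∀ k m → 0 < k * m → 0 < k × 0 < m
product>0⇒factors>0 k m km>0 =
  >-nonZero⁻¹ k {{m*n≢0⇒m≢0 k {{>-nonZero km>0}}}} ,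
  >-nonZero⁻¹ m {{m*n≢0⇒n≢0 k {{>-nonZero km>0}}}}

dense⇒nonempty : ∀ {n} (T : Fin n → Fin n → Bool) (L R : Subset n) →
                 ½ ≤ℚ density T L R → 0 < ∣ L ∣ × 0 < ∣ R ∣
dense⇒nonempty T L R ½≤d =
  product>0⇒factors>0 ∣ L ∣ ∣ R ∣ (½≤ratio⇒denominator>0 (arcs T L R) _ ½≤d)

two-children-bound : ∀ {iL iR l r} → suc iL ≤ l → suc iR ≤ r →
                     suc (suc (iL + iR)) ≤ l + r
two-children-bound {iL} {iR} {l} {r} iL<l iR<r =
  subst (_≤ l + r) (cong suc (+-suc iL iR)) (+-mono-≤ iL<l iR<r)

three-children-bound : ∀ {iL iR iW l r w} →
                       suc iL ≤ l → suc iR ≤ r → suc iW ≤ w →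
                       suc (suc (iL + iR + iW)) ≤ l + (r + w)
three-children-bound {iL} {iR} {iW} {l} {r} {w} iL<l iR<r iW<w =
  subst (_≤ l + (r + w)) (cong (λ k → suc (suc k)) (sym (+-assoc iL iR iW)))
    (two-children-bound iL<l (≤-trans (n≤1+n _) (two-children-bound iR<r iW<w)))

module _ {n : ℕ} {T : Fin n → Fin n → Bool} {δ β : ℚ} where

  -- The universe [n] of a procedure tree is nonempty: a leaf satisfies
  -- |V|² < n, and a processed node has a nonempty child L ⊆ [n].
  procTree⇒n>0 : ∀ {V} → ProcTree n T δ β V → 0 < n
  procTree⇒n>0 (leaf |V|²<n) = ≤-<-trans z≤n |V|²<n
  procTree⇒n>0 (node L R _ _ _ _ _ _ ½≤d _ _ _) =
    <-≤-trans (proj₁ (dense⇒nonempty T L R ½≤d)) (∣p∣≤n L)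

  internalNodes<size : ∀ {V} (t : ProcTree n T δ β V) → 0 < ∣ V ∣ →
                       suc (internalNodes t) ≤ ∣ V ∣
  internalNodes<size (leaf _) |V|>0 = |V|>0
  internalNodes<size {V} (node L R W _ part _ _ _ ½≤d tL tR (inj₁ refl)) _ =
    begin
      suc (suc (internalNodes tL + internalNodes tR))
        ≤⟨ two-children-bound (internalNodes<size tL |L|>0) (internalNodes<size tR |R|>0) ⟩
      ∣ L ∣ + ∣ R ∣
        ≡⟨ cong (∣ L ∣ +_) (sym (+-identityʳ ∣ R ∣)) ⟩
      ∣ L ∣ + (∣ R ∣ + 0)
        ≡⟨ cong (λ k → ∣ L ∣ + (∣ R ∣ + k)) (sym (∣⊥∣≡0 n)) ⟩
      ∣ L ∣ + (∣ R ∣ + ∣ ⊥ {n} ∣)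
        ≡⟨ sym (partition-size part) ⟩
      ∣ V ∣ ∎
    where
    open ≤-Reasoning
    |L|>0 : 0 < ∣ L ∣
    |L|>0 = proj₁ (dense⇒nonempty T L R ½≤d)
    |R|>0 : 0 < ∣ R ∣
    |R|>0 = proj₂ (dense⇒nonempty T L R ½≤d)
  internalNodes<size {V} (node L R W _ part _ _ _ ½≤d tL tR (inj₂ (W≠∅ , tW))) _ =
    subst (_ ≤_) (sym (partition-size part))
      (three-children-bound (internalNodes<size tL |L|>0) (internalNodes<size tR |R|>0)
                            (internalNodes<size tW (nonempty⇒size>0 W≠∅)))
    where
    |L|>0 : 0 < ∣ L ∣
    |L|>0 = proj₁ (dense⇒nonempty T L R ½≤d)
    |R|>0 : 0 < ∣ R ∣
    |R|>0 = proj₂ (dense⇒nonempty T L R ½≤d)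

lemma3p3 : (δ β : ℚ) → 0ℚ <ℚ δ → 0ℚ <ℚ β →
    (n : ℕ) (T : Fin n → Fin n → Bool) → IsTournament n T →
    (t : ProcTree n T δ β ⊤) → internalNodes t < n
lemma3p3 δ β _ _ n T _ t =
  subst (internalNodes t <_) (∣⊤∣≡n n) (internalNodes<size t |⊤|>0)
  where
  |⊤|>0 : 0 < ∣ ⊤ {n} ∣
  |⊤|>0 = subst (0 <_) (sym (∣⊤∣≡n n)) (procTree⇒n>0 t)
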